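{- For $n\ge 1$, \[ \sum_{\sigma\in\mathfrak{S}_n} (-1)^{\mathsf{inv}(\sigma)} s^{\mathsf{exc}(\sigma)} t^{\mathsf{depth}(\sigma)}=(1-st)^{n-1}. \]
   Context: $\mathfrak{S}_n$ is the symmetric group of permutations $\sigma=\sigma(1)\cdots\sigma(n)$ of $[n]=\{1,\dots,n\}$. $\mathsf{inv}(\sigma)$ is the number of pairs $(i,j)$ with $1\le i<j\le n$ and $\sigma(i)>\sigma(j)$. $\mathsf{exc}(\sigma)$ is the number of indices $i$ with $\sigma(i)>i$. $\mathsf{depth}(\sigma)=\sum_{i:\sigma(i)>i}(\sigma(i)-i)$. $s,t$ are indeterminates. -}

module Defs where

open import Level using (Level)
open import Data.Bool using (Bool; true; false; if_then_else_; _∧_)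
open import Data.Nat using (ℕ; zero; suc; _∸_; _<ᵇ_; _≡ᵇ_)
import Data.Nat as ℕ
open import Data.Nat.ListAction using (sum)
open import Data.Fin using (Fin; toℕ)
open import Data.List using (List; []; _∷_; map; concatMap; filter; foldr; allFin; length)
open import Data.Vec using (Vec; []; _∷_; lookup)
open import Algebra.Bundles using (CommutativeRing)

-- A permutation of [n] is represented in one-line notation as a vector
-- σ = σ(1)⋯σ(n) of entries in Fin n (0-based: entry i stands for i+1)
-- whose entries are pairwise distinct (hence a bijection of Fin n).

allVecs : (m k : ℕ) → List (Vec (Fin m) k)
allVecs m zero    = [] ∷ []
allVecs m (suc k) = concatMap (λ x → map (x ∷_) (allVecs m k)) (allFin m)

notIn : {m : ℕ} → Fin m → {k : ℕ} → Vec (Fin m) k → Bool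
notIn x []       = true
notIn x (y ∷ ys) = if toℕ x ≡ᵇ toℕ y then false else notIn x ys

distinct : {m k : ℕ} → Vec (Fin m) k → Bool
distinct []       = true
distinct (x ∷ xs) = notIn x xs ∧ distinct xs

Sym : (n : ℕ) → List (Vec (Fin n) n)
Sym n = filter (λ v → Data.Bool.T? (distinct v)) (allVecs n n)
  where import Data.Bool

count : {A : Set} → (A → Bool) → List A → ℕ
count p []       = 0
count p (x ∷ xs) = (if p x then 1 else 0) ℕ.+ count p xs

inv : {n : ℕ} → Vec (Fin n) n → ℕ
inv {n} σ = sum (map (λ i → count (λ j → (toℕ i <ᵇ toℕ j) ∧ (toℕ (lookup σ j) <ᵇ toℕ (lookup σ i))) (allFin n)) (allFin n))

exc : {n : ℕ} → Vec (Fin n) n → ℕ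
exc {n} σ = count (λ i → toℕ i <ᵇ toℕ (lookup σ i)) (allFin n)

depth : {n : ℕ} → Vec (Fin n) n → ℕ
depth {n} σ = sum (map (λ i → if toℕ i <ᵇ toℕ (lookup σ i) then toℕ (lookup σ i) ∸ toℕ i else 0) (allFin n))

module _ {c ℓ : Level} (R : CommutativeRing c ℓ) where
  open CommutativeRing R

  pow : Carrier → ℕ → Carrier
  pow x zero    = 1#
  pow x (suc k) = x * pow x k

  ringSum : List Carrier → Carrier
  ringSum = foldr _+_ 0#

  signedExcDepth : (n : ℕ) → Carrier → Carrier → Carrier
  signedExcDepth n s t =
    ringSum (map (λ σ → pow (- 1#) (inv σ) * (pow s (exc σ) * pow t (depth σ))) (Sym n))

-- Put w i j = s t^(j - i) for i < j and w i j = 1 otherwise. Then the term of σ is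
-- (-1)^inv(σ) ∏ᵢ w i σ(i), so the sum is the Leibniz formula for the determinant of (w i j)_{i,j<n}.
-- Peeling off the first letter of σ turns it into the Laplace expansion along the first row; the
-- signs match exactly if each step counts the inversions between the letters already used and the
-- rest of the word. From row i on, every column j ≤ i of w is constantly 1, so a minor containing two
-- such columns vanishes. Expanding the minor on the rows i, i + 1, … and the columns c, i + 1, …, i + k
-- (with c ≤ i) along its first row therefore leaves only the column c (entry 1) and the column i + 1
-- (entry st, sign -1), whose minors have the same shape again; so the minor equals (1 - st)^k.

{-# OPTIONS --safe #-}
module Submission where

open import Defs
open import Level using (Level)
open import Data.Nat using (ℕ; suc; z≤n)
open import Data.List using ([]; _∷_; length)
open import Algebra.Bundles using (CommutativeRing)
import Relation.Binary.PropositionalEquality as ≡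

module Counting where

  open import Data.Bool using (Bool; true; false; if_then_else_; _∧_; not; T?)
  open import Data.Unit using (tt)
  open import Function using (_∘_; id)
  open import Data.Nat using (ℕ; zero; suc; _+_; _∸_; _<ᵇ_; _≡ᵇ_; _<_; _≤_; z≤n)
  open import Data.Nat.Properties
  open import Data.Nat.ListAction using (sum)
  open import Data.Nat.Tactic.RingSolver using (solve-∀)
  open import Data.Fin as Fin using (Fin; toℕ)
  open import Data.List using (List; []; _∷_; map; filterᵇ; tabulate; allFin; length)
  open import Data.List.Properties using (map-tabulate; tabulate-cong; filter-all)
  open import Data.List.Relation.Unary.All as All using (All; []; _∷_)
  open import Data.Vec using (Vec; []; _∷_; lookup; toList)
  open import Algebra.Properties.Monoid.Sum +-0-monoid using (sum-syntax; sum-cong-≗)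
  open import Algebra.Properties.CommutativeSemigroup +-commutativeSemigroup using (interchange; x∙yz≈y∙xz)
  open import Relation.Binary.PropositionalEquality hiding ([_])
  open import Relation.Nullary.Decidable using (proof; dec-false)
  open import Relation.Nullary.Reflects using (Reflects; ofʸ; ofⁿ)
  open import Relation.Nullary.Negation using (contradiction)

  [_] : Bool → ℕ
  [ b ] = if b then 1 else 0

  -- does (m ≟ n) and does (m <? n) compute to m ≡ᵇ n and m <ᵇ n, so dec-true and dec-false
  -- evaluate these boolean tests throughout.
  ≡ᵇ-reflects : ∀ m n → Reflects (m ≡ n) (m ≡ᵇ n)
  ≡ᵇ-reflects m n = proof (m ≟ n)

  below : ℕ → List ℕ → ℕ
  below u = count (_<ᵇ u)

  above : ℕ → List ℕ → ℕ
  above u = count (u <ᵇ_)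

  occurrences : ℕ → List ℕ → ℕ
  occurrences x = count (x ≡ᵇ_)

  remove : ℕ → List ℕ → List ℕ
  remove x = filterᵇ (λ y → not (x ≡ᵇ y))

  crossings : List ℕ → List ℕ → ℕ
  crossings []      C = 0
  crossings (u ∷ U) C = below u C + crossings U C

  _∉ᵇ_ : ℕ → List ℕ → Bool
  y ∉ᵇ []      = true
  y ∉ᵇ (u ∷ U) = if u ≡ᵇ y then false else y ∉ᵇ U

  range : ℕ → ℕ → List ℕ
  range a zero    = []
  range a (suc m) = a ∷ range (suc a) m

  complement : ℕ → List ℕ → List ℕ
  complement n U = filterᵇ (_∉ᵇ U) (range 0 n)

  count-none : ∀ {A : Set} {p : A → Bool} {L} → All (λ y → p y ≡ false) L → count p L ≡ 0
  count-none []                    = refl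
  count-none (py ∷ pL) rewrite py = count-none pL

  count-filterᵇ : ∀ {A : Set} {p q : A → Bool} → (∀ y → q y ≡ true → p y ≡ true) →
                  ∀ L → count q (filterᵇ p L) ≡ count q L
  count-filterᵇ q⇒p [] = refl
  count-filterᵇ {p = p} {q} q⇒p (y ∷ L) with p y in py
  ... | true  = cong ([ q y ] +_) (count-filterᵇ q⇒p L)
  ... | false with q y in qy
  ...   | false = count-filterᵇ q⇒p L
  ...   | true  = contradiction (trans (sym py) (q⇒p y qy)) λ ()

  below-min : ∀ {x L} → All (x <_) L → below x L ≡ 0
  below-min = count-none ∘ All.map (λ x<y → dec-false (_ <? _) (<⇒≯ x<y))

  remove-min : ∀ {x L} → All (x <_) L → remove x L ≡ L
  remove-min []                = refl
  remove-min {x} (x<y ∷ x<L) rewrite dec-false (x ≟ _) (<⇒≢ x<y) = cong (_ ∷_) (remove-min x<L)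

  below-remove : ∀ u x L → below u L ≡ below u (remove x L) + (if x <ᵇ u then occurrences x L else 0)
  below-remove u x [] with x <ᵇ u
  ... | true  = refl
  ... | false = refl
  below-remove u x (y ∷ L) with x ≡ᵇ y | ≡ᵇ-reflects x y
  ... | false | _ = trans (cong ([ y <ᵇ u ] +_) (below-remove u x L)) (sym (+-assoc [ y <ᵇ u ] _ _))
  ... | true  | ofʸ refl with x <ᵇ u | below-remove u x L
  ...   | true  | ih = trans (cong suc ih) (sym (+-suc _ _))
  ...   | false | ih = ih

  below-remove-self : ∀ x L → below x (remove x L) ≡ below x L
  below-remove-self x L rewrite below-remove x x L | dec-false (x <? x) (<-irrefl refl) =
    sym (+-identityʳ _)

  length-remove : ∀ x L → length (remove x L) + occurrences x L ≡ length L
  length-remove x [] = refl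
  length-remove x (y ∷ L) with x ≡ᵇ y
  ... | true  = trans (+-suc _ _) (cong suc (length-remove x L))
  ... | false = cong suc (length-remove x L)

  All-range : ∀ a m → All (a ≤_) (range a m)
  All-range a zero    = []
  All-range a (suc m) = ≤-refl ∷ All.map <⇒≤ (All-range (suc a) m)

  length-range : ∀ a m → length (range a m) ≡ m
  length-range a zero    = refl
  length-range a (suc m) = cong suc (length-range (suc a) m)

  tabulate-range : ∀ a m → tabulate (λ (i : Fin m) → a + toℕ i) ≡ range a m
  tabulate-range a zero    = refl
  tabulate-range a (suc m) =
    cong₂ _∷_ (+-identityʳ a) (trans (tabulate-cong (λ i → +-suc a (toℕ i))) (tabulate-range (suc a) m))

  map-toℕ-allFin : ∀ m → map toℕ (allFin m) ≡ range 0 m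
  map-toℕ-allFin m = trans (map-tabulate id toℕ) (tabulate-range 0 m)

  occurrences-range : ∀ {a x} m → a ≤ x → x < a + m → occurrences x (range a m) ≡ 1
  occurrences-range {a} zero a≤x x<a+0 =
    contradiction (≤-trans x<a+0 (≤-reflexive (+-identityʳ a))) (≤⇒≯ a≤x)
  occurrences-range {a} {x} (suc m) a≤x x<a+m with x ≡ᵇ a | ≡ᵇ-reflects x a
  ... | true  | ofʸ refl =
    cong suc (count-none (All.map (λ x<y → dec-false (x ≟ _) (<⇒≢ x<y)) (All-range (suc x) m)))
  ... | false | ofⁿ x≢a  =
    occurrences-range m (≤∧≢⇒< a≤x (≢-sym x≢a)) (subst (x <_) (+-suc a m) x<a+m)

  occurrences-complement : ∀ {n y} U → y < n → (y ∉ᵇ U) ≡ true → occurrences y (complement n U) ≡ 1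
  occurrences-complement {n} {y} U y<n y∉U =
    trans (count-filterᵇ y∉U′ (range 0 n)) (occurrences-range n z≤n y<n)
    where
    y∉U′ : ∀ z → (y ≡ᵇ z) ≡ true → (z ∉ᵇ U) ≡ true
    y∉U′ z with y ≡ᵇ z | ≡ᵇ-reflects y z
    ... | true  | ofʸ refl = λ _ → y∉U
    ... | false | _        = λ ()

  complement-[] : ∀ n → complement n [] ≡ range 0 n
  complement-[] n = filter-all (T? ∘ (_∉ᵇ [])) (All.universal (λ _ → tt) (range 0 n))

  complement-∷ : ∀ n y U → complement n (y ∷ U) ≡ remove y (complement n U)
  complement-∷ n y U = go (range 0 n)
    where
    go : ∀ L → filterᵇ (_∉ᵇ (y ∷ U)) L ≡ remove y (filterᵇ (_∉ᵇ U) L)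
    go [] = refl
    go (z ∷ L) with y ≡ᵇ z in y≡ᵇz | z ∉ᵇ U
    ... | true  | true  rewrite y≡ᵇz = go L
    ... | true  | false = go L
    ... | false | true  rewrite y≡ᵇz = cong (z ∷_) (go L)
    ... | false | false = go L

  length-complement-∷ : ∀ {n y k} U → y < n → (y ∉ᵇ U) ≡ true → length (complement n U) ≡ suc k →
    length (complement n (y ∷ U)) ≡ k
  length-complement-∷ {n} {y} {k} U y<n y∉U len rewrite complement-∷ n y U = suc-injective (begin
    suc (length (remove y C))              ≡⟨ +-comm 1 _ ⟩
    length (remove y C) + 1                ≡⟨ cong (length (remove y C) +_) (occurrences-complement U y<n y∉U) ⟨
    length (remove y C) + occurrences y C  ≡⟨ length-remove y C ⟩
    length C                               ≡⟨ len ⟩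
    suc k                                  ∎)
    where
    open ≡-Reasoning
    C = complement n U

  crossings-consʳ : ∀ U x C → crossings U (x ∷ C) ≡ above x U + crossings U C
  crossings-consʳ []      x C = refl
  crossings-consʳ (u ∷ U) x C =
    trans (cong ([ x <ᵇ u ] + below u C +_) (crossings-consʳ U x C)) (interchange [ x <ᵇ u ] _ _ _)

  above-crossings-remove : ∀ y C U → occurrences y C ≡ 1 →
    above y U + crossings U (remove y C) ≡ crossings U C
  above-crossings-remove y C []      once = refl
  above-crossings-remove y C (u ∷ U) once = begin
    ([ y <ᵇ u ] + above y U) + (below u (remove y C) + crossings U (remove y C))
      ≡⟨ interchange [ y <ᵇ u ] _ _ _ ⟩
    ([ y <ᵇ u ] + below u (remove y C)) + (above y U + crossings U (remove y C))
      ≡⟨ cong₂ _+_ (trans (+-comm [ y <ᵇ u ] _) (sym below-u)) (above-crossings-remove y C U once) ⟩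
    below u C + crossings U C ∎
    where
    open ≡-Reasoning
    below-u : below u C ≡ below u (remove y C) + [ y <ᵇ u ]
    below-u with y <ᵇ u | below-remove u y C
    ... | true  | e = trans e (cong (below u (remove y C) +_) once)
    ... | false | e = e

  crossings-transfer : ∀ y C U → occurrences y C ≡ 1 →
    above y U + crossings (y ∷ U) (remove y C) ≡ crossings U C + below y C
  crossings-transfer y C U once = begin
    above y U + (below y (remove y C) + crossings U (remove y C))
      ≡⟨ x∙yz≈y∙xz (above y U) (below y (remove y C)) _ ⟩
    below y (remove y C) + (above y U + crossings U (remove y C))
      ≡⟨ cong₂ _+_ (below-remove-self y C) (above-crossings-remove y C U once) ⟩
    below y C + crossings U C
      ≡⟨ +-comm (below y C) _ ⟩
    crossings U C + below y C ∎
    where open ≡-Reasoning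

  values : ∀ {m k} → Vec (Fin m) k → List ℕ
  values v = map toℕ (toList v)

  inversions : ∀ {m k} → Vec (Fin m) k → ℕ
  inversions []      = 0
  inversions (x ∷ v) = below (toℕ x) (values v) + inversions v

  -- The inversions of a word U v (U in any order) that involve a letter of v.
  disorder : ∀ {m k} → List ℕ → Vec (Fin m) k → ℕ
  disorder U v = crossings U (values v) + inversions v

  disorder-∷ : ∀ {m k} U (x : Fin m) (v : Vec (Fin m) k) →
    disorder U (x ∷ v) ≡ above (toℕ x) U + disorder (toℕ x ∷ U) v
  disorder-∷ U x v rewrite crossings-consʳ U (toℕ x) (values v) =
    regroup (above (toℕ x) U) (crossings U (values v)) (below (toℕ x) (values v)) (inversions v)
    where
    regroup : ∀ a c b i → (a + c) + (b + i) ≡ a + ((b + c) + i)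
    regroup = solve-∀

  rowSum : ∀ {m k} → (ℕ → ℕ → ℕ) → ℕ → Vec (Fin m) k → ℕ
  rowSum g p []      = 0
  rowSum g p (x ∷ v) = g p (toℕ x) + rowSum g (suc p) v

  excedanceAt : ℕ → ℕ → ℕ
  excedanceAt i j = [ i <ᵇ j ]

  depthAt : ℕ → ℕ → ℕ
  depthAt i j = if i <ᵇ j then j ∸ i else 0

  count-tabulate : ∀ {A : Set} {k} (p : A → Bool) (f : Fin k → A) →
    count p (tabulate f) ≡ ∑[ i < k ] [ p (f i) ]
  count-tabulate {k = zero}  p f = refl
  count-tabulate {k = suc k} p f = cong ([ p (f Fin.zero) ] +_) (count-tabulate p (f ∘ Fin.suc))

  sum-map-tabulate : ∀ {A : Set} {k} (h : A → ℕ) (f : Fin k → A) →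
    sum (map h (tabulate f)) ≡ ∑[ i < k ] h (f i)
  sum-map-tabulate {k = zero}  h f = refl
  sum-map-tabulate {k = suc k} h f = cong (h (f Fin.zero) +_) (sum-map-tabulate h (f ∘ Fin.suc))

  below-values : ∀ {m k} u (v : Vec (Fin m) k) →
    below u (values v) ≡ ∑[ j < k ] [ toℕ (lookup v j) <ᵇ u ]
  below-values u []      = refl
  below-values u (y ∷ v) = cong ([ toℕ y <ᵇ u ] +_) (below-values u v)

  inversions-∑ : ∀ {m k} (v : Vec (Fin m) k) →
    inversions v ≡ ∑[ i < k ] ∑[ j < k ] [ (toℕ i <ᵇ toℕ j) ∧ (toℕ (lookup v j) <ᵇ toℕ (lookup v i)) ]
  inversions-∑ []      = refl
  inversions-∑ (x ∷ v) = cong₂ _+_ (below-values (toℕ x) v) (inversions-∑ v)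

  rowSum-∑ : ∀ {m k} g p (v : Vec (Fin m) k) →
    rowSum g p v ≡ ∑[ i < k ] g (p + toℕ i) (toℕ (lookup v i))
  rowSum-∑ g p []      = refl
  rowSum-∑ g p (x ∷ v) = cong₂ _+_ (cong (λ q → g q (toℕ x)) (sym (+-identityʳ p))) (trans (rowSum-∑ g (suc p) v)
    (sum-cong-≗ λ i → cong (λ q → g q (toℕ (lookup v i))) (sym (+-suc p (toℕ i)))))

  inv≡inversions : ∀ {n} (σ : Vec (Fin n) n) → inv σ ≡ inversions σ
  inv≡inversions {n} σ = begin
    inv σ                                     ≡⟨ sum-map-tabulate (λ i → count (inverted i) (allFin n)) id ⟩
    ∑[ i < n ] count (inverted i) (allFin n)  ≡⟨ sum-cong-≗ (λ i → count-tabulate (inverted i) id) ⟩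
    ∑[ i < n ] ∑[ j < n ] [ inverted i j ]    ≡⟨ inversions-∑ σ ⟨
    inversions σ                              ∎
    where
    open ≡-Reasoning
    inverted : Fin n → Fin n → Bool
    inverted i j = (toℕ i <ᵇ toℕ j) ∧ (toℕ (lookup σ j) <ᵇ toℕ (lookup σ i))

  exc≡rowSum : ∀ {n} (σ : Vec (Fin n) n) → exc σ ≡ rowSum excedanceAt 0 σ
  exc≡rowSum σ = trans (count-tabulate (λ i → toℕ i <ᵇ toℕ (lookup σ i)) id) (sym (rowSum-∑ _ 0 σ))

  depth≡rowSum : ∀ {n} (σ : Vec (Fin n) n) → depth σ ≡ rowSum depthAt 0 σ
  depth≡rowSum σ =
    trans (sum-map-tabulate (λ i → depthAt (toℕ i) (toℕ (lookup σ i))) id) (sym (rowSum-∑ depthAt 0 σ))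

module Determinants {c ℓ : Level} (R : CommutativeRing c ℓ) where

  open import Data.Bool using (Bool; true; false; if_then_else_; _∧_)
  open import Data.Bool.Properties using (∧-zeroʳ; ∧-identityʳ; ∧-commutativeMonoid)
  open import Data.Nat using (ℕ; zero; suc; _∸_; _<ᵇ_; _≡ᵇ_; _<_; _≤_; s≤s; _<?_; _≟_)
    renaming (_+_ to _+ℕ_)
  open import Data.Nat.Properties
    using (≤-refl; ≤-trans; <-trans; <-irrefl; >⇒≢; <⇒≤; ≤⇒≯; m≤n⇒m≤1+n; m+n∸n≡m)
    renaming (+-identityʳ to +ℕ-identityʳ)
  open import Data.Fin using (Fin; toℕ)
  open import Data.Fin.Properties using (toℕ<n)
  open import Data.List using (List; []; _∷_; map; filterᵇ; concatMap; _++_; allFin; length)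
  open import Data.List.Properties using (map-∘)
  open import Data.List.Relation.Unary.All as All using (All; []; _∷_)
  open import Data.List.Relation.Unary.All.Properties using (filter⁺)
  open import Data.Vec using (Vec; []; _∷_)
  open import Function using (_∘_)
  import Relation.Binary.PropositionalEquality as ≡
  open ≡ using (_≡_)
  open import Relation.Nullary.Decidable using (dec-true; dec-false)
  import Algebra.Properties.CommutativeSemigroup as CommutativeSemigroupProperties
  open import Algebra.Bundles using (CommutativeMonoid)
  module ∧ = CommutativeSemigroupProperties (CommutativeMonoid.commutativeSemigroup ∧-commutativeMonoid)
  open Counting

  open CommutativeRing R hiding (zero)
  open import Relation.Binary.Reasoning.Setoid setoid
  open import Algebra.Properties.Ring ring using (-1*x≈-x; -‿distribˡ-*)
  module * = CommutativeSemigroupProperties *-commutativeSemigroup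

  ∑ : ∀ {A : Set} → (A → Carrier) → List A → Carrier
  ∑ f L = ringSum R (map f L)

  syntax ∑ (λ x → e) L = ∑[ x ∈ L ] e

  ∑-cong : ∀ {A : Set} {f g : A → Carrier} {L} → All (λ x → f x ≈ g x) L → ∑ f L ≈ ∑ g L
  ∑-cong []       = refl
  ∑-cong (e ∷ es) = +-cong e (∑-cong es)

  ∑-zero : ∀ {A : Set} {f : A → Carrier} {L} → All (λ x → f x ≈ 0#) L → ∑ f L ≈ 0#
  ∑-zero []       = refl
  ∑-zero (e ∷ es) = trans (+-cong e (∑-zero es)) (+-identityˡ 0#)

  ∑-++ : ∀ {A : Set} (f : A → Carrier) xs ys → ∑ f (xs ++ ys) ≈ ∑ f xs + ∑ f ys
  ∑-++ f []       ys = sym (+-identityˡ _)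
  ∑-++ f (x ∷ xs) ys = trans (+-congˡ (∑-++ f xs ys)) (sym (+-assoc _ _ _))

  ∑-concatMap : ∀ {A B : Set} (f : B → Carrier) (g : A → List B) L →
    ∑ f (concatMap g L) ≈ ∑[ x ∈ L ] ∑ f (g x)
  ∑-concatMap f g []      = refl
  ∑-concatMap f g (x ∷ L) = trans (∑-++ f (g x) (concatMap g L)) (+-congˡ (∑-concatMap f g L))

  ∑-map : ∀ {A B : Set} (f : B → Carrier) (g : A → B) L → ∑ f (map g L) ≡ ∑ (f ∘ g) L
  ∑-map f g L = ≡.cong (ringSum R) (≡.sym (map-∘ L))

  ∑-filterᵇ : ∀ {A : Set} (f : A → Carrier) (p : A → Bool) L →
    ∑ f (filterᵇ p L) ≈ ∑[ x ∈ L ] (if p x then f x else 0#)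
  ∑-filterᵇ f p []      = refl
  ∑-filterᵇ f p (x ∷ L) with p x
  ... | true  = +-congˡ (∑-filterᵇ f p L)
  ... | false = trans (∑-filterᵇ f p L) (sym (+-identityˡ _))

  *-distribˡ-∑ : ∀ {A : Set} a (f : A → Carrier) L → a * ∑ f L ≈ ∑[ x ∈ L ] (a * f x)
  *-distribˡ-∑ a f []      = zeroʳ a
  *-distribˡ-∑ a f (x ∷ L) = trans (distribˡ a _ _) (+-congˡ (*-distribˡ-∑ a f L))

  ∑-if : ∀ {A : Set} b c (f : A → Carrier) L →
    ∑[ x ∈ L ] (if b then c * f x else 0#) ≈ (if b then c * ∑ f L else 0#)
  ∑-if true  c f L = sym (*-distribˡ-∑ c f L)
  ∑-if false c f L = ∑-zero (All.universal (λ _ → refl) L)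

  ∑-complement : ∀ n U (f : ℕ → Carrier) →
    ∑[ x ∈ allFin n ] (if toℕ x ∉ᵇ U then f (toℕ x) else 0#) ≈ ∑ f (complement n U)
  ∑-complement n U f = begin
    ∑ (g ∘ toℕ) (allFin n)      ≡⟨ ∑-map g toℕ (allFin n) ⟨
    ∑ g (map toℕ (allFin n))    ≡⟨ ≡.cong (∑ g) (map-toℕ-allFin n) ⟩
    ∑ g (range 0 n)             ≈⟨ ∑-filterᵇ f (_∉ᵇ U) (range 0 n) ⟨
    ∑ f (complement n U)        ∎
    where
    g : ℕ → Carrier
    g y = if y ∉ᵇ U then f y else 0#

  pow-homo-* : ∀ x m n → pow R x (m +ℕ n) ≈ pow R x m * pow R x n
  pow-homo-* x zero    n = sym (*-identityˡ _)
  pow-homo-* x (suc m) n = trans (*-congˡ (pow-homo-* x m n)) (sym (*-assoc _ _ _))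

  sign : ℕ → Carrier
  sign = pow R (- 1#)

  module Laplace (a : ℕ → ℕ → Carrier) where

    -- Laplace expansion along the first row: det k i C is the determinant of the k × k submatrix of a
    -- on the rows i, …, i + k ∸ 1 and the columns in C (duplicate-free, ordered by value).
    det : ℕ → ℕ → List ℕ → Carrier
    det zero    i []      = 1#
    det zero    i (_ ∷ _) = 0#
    det (suc k) i C       = ∑[ y ∈ C ] (sign (below y C) * (a i y * det k (suc i) (remove y C)))

    ColumnsAgreeFrom : ℕ → ℕ → ℕ → Set ℓ
    ColumnsAgreeFrom i c c′ = ∀ j → i ≤ j → a j c ≈ a j c′

    agree-suc : ∀ {i c c′} → ColumnsAgreeFrom i c c′ → ColumnsAgreeFrom (suc i) c c′
    agree-suc agree j i<j = agree j (<⇒≤ i<j)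

    agree-sym : ∀ {i c c′} → ColumnsAgreeFrom i c c′ → ColumnsAgreeFrom i c′ c
    agree-sym agree j i≤j = sym (agree j i≤j)

    otherColumns : ℕ → ℕ → ℕ → List ℕ → Carrier
    otherColumns k i c rest =
      ∑[ y ∈ rest ] (sign (suc (below y rest)) * (a i y * det k (suc i) (c ∷ remove y rest)))

    det-expand-min : ∀ k i c rest → All (c <_) rest →
      det (suc k) i (c ∷ rest) ≈ a i c * det k (suc i) rest + otherColumns k i c rest
    det-expand-min k i c rest c<rest = +-cong first (∑-cong (All.map other c<rest))
      where
      first : sign (below c (c ∷ rest)) * (a i c * det k (suc i) (remove c (c ∷ rest))) ≈
              a i c * det k (suc i) rest
      first rewrite dec-false (c <? c) (<-irrefl ≡.refl) | below-min c<rest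
                  | dec-true (c ≟ c) ≡.refl | remove-min c<rest = *-identityˡ _
      other : ∀ {y} → c < y →
        sign (below y (c ∷ rest)) * (a i y * det k (suc i) (remove y (c ∷ rest))) ≈
        sign (suc (below y rest)) * (a i y * det k (suc i) (c ∷ remove y rest))
      other {y} c<y rewrite dec-true (c <? y) c<y | dec-false (y ≟ c) (>⇒≢ c<y) = refl

    det-first-column-cong : ∀ k i c c′ rest → ColumnsAgreeFrom i c c′ →
      All (c <_) rest → All (c′ <_) rest → det k i (c ∷ rest) ≈ det k i (c′ ∷ rest)
    det-first-column-cong zero    i c c′ rest agree c<rest c′<rest = refl
    det-first-column-cong (suc k) i c c′ rest agree c<rest c′<rest = begin
      det (suc k) i (c ∷ rest)
        ≈⟨ det-expand-min k i c rest c<rest ⟩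
      a i c * det k (suc i) rest + otherColumns k i c rest
        ≈⟨ +-cong (*-congʳ (agree i ≤-refl)) (∑-cong (All.universal minor rest)) ⟩
      a i c′ * det k (suc i) rest + otherColumns k i c′ rest
        ≈⟨ det-expand-min k i c′ rest c′<rest ⟨
      det (suc k) i (c′ ∷ rest) ∎
      where
      minor : ∀ y → sign (suc (below y rest)) * (a i y * det k (suc i) (c ∷ remove y rest)) ≈
                    sign (suc (below y rest)) * (a i y * det k (suc i) (c′ ∷ remove y rest))
      minor y = *-congˡ (*-congˡ (det-first-column-cong k (suc i) c c′ (remove y rest) (agree-suc agree)
                                                        (filter⁺ _ c<rest) (filter⁺ _ c′<rest)))

    det-equal-columns : ∀ k i c₀ c₁ rest → c₀ < c₁ → ColumnsAgreeFrom i c₀ c₁ → All (c₁ <_) rest →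
      det k i (c₀ ∷ c₁ ∷ rest) ≈ 0#
    det-equal-columns zero    i c₀ c₁ rest c₀<c₁ agree c₁<rest = refl
    det-equal-columns (suc k) i c₀ c₁ rest c₀<c₁ agree c₁<rest = begin
      det (suc k) i (c₀ ∷ c₁ ∷ rest)
        ≈⟨ det-expand-min k i c₀ (c₁ ∷ rest) (c₀<c₁ ∷ c₀<rest) ⟩
      a i c₀ * det k (suc i) (c₁ ∷ rest) + (second + ∑[ y ∈ rest ] later y)
        ≈⟨ +-cong (*-cong (agree i ≤-refl) swap) (+-cong second≈ (∑-zero (All.map later≈0 c₁<rest))) ⟩
      a i c₁ * det k (suc i) (c₀ ∷ rest) + (- (a i c₁ * det k (suc i) (c₀ ∷ rest)) + 0#)
        ≈⟨ trans (+-congˡ (+-identityʳ _)) (-‿inverseʳ _) ⟩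
      0# ∎
      where
      c₀<rest = All.map (<-trans c₀<c₁) c₁<rest
      swap : det k (suc i) (c₁ ∷ rest) ≈ det k (suc i) (c₀ ∷ rest)
      swap = det-first-column-cong k (suc i) c₁ c₀ rest (agree-suc (agree-sym agree)) c₁<rest c₀<rest
      second : Carrier
      second = sign (suc (below c₁ (c₁ ∷ rest))) * (a i c₁ * det k (suc i) (c₀ ∷ remove c₁ (c₁ ∷ rest)))
      second≈ : second ≈ - (a i c₁ * det k (suc i) (c₀ ∷ rest))
      second≈ rewrite dec-false (c₁ <? c₁) (<-irrefl ≡.refl) | below-min c₁<rest
                    | dec-true (c₁ ≟ c₁) ≡.refl | remove-min c₁<rest
        = trans (*-congʳ (*-identityʳ (- 1#))) (-1*x≈-x _)
      later : ℕ → Carrier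
      later y = sign (suc (below y (c₁ ∷ rest))) * (a i y * det k (suc i) (c₀ ∷ remove y (c₁ ∷ rest)))
      later≈0 : ∀ {y} → c₁ < y → later y ≈ 0#
      later≈0 {y} c₁<y rewrite dec-false (y ≟ c₁) (>⇒≢ c₁<y) = trans (*-congˡ (trans (*-congˡ
        (det-equal-columns k (suc i) c₀ c₁ (remove y rest) c₀<c₁ (agree-suc agree) (filter⁺ _ c₁<rest)))
        (zeroʳ _))) (zeroʳ _)

  module Leibniz (a : ℕ → ℕ → Carrier) (n : ℕ) where

    open Laplace a

    weight : ∀ {k} → ℕ → Vec (Fin n) k → Carrier
    weight i []      = 1#
    weight i (x ∷ v) = a i (toℕ x) * weight (suc i) v

    avoids : ∀ {k} → List ℕ → Vec (Fin n) k → Bool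
    avoids U []      = true
    avoids U (x ∷ v) = (toℕ x ∉ᵇ U) ∧ avoids U v

    term : ∀ {k} → ℕ → List ℕ → Vec (Fin n) k → Carrier
    term i U v = if distinct v ∧ avoids U v then sign (disorder U v) * weight i v else 0#

    leibniz : ℕ → ℕ → List ℕ → Carrier
    leibniz k i U = ∑ (term i U) (allVecs n k)

    firstLetter : ℕ → ℕ → List ℕ → ℕ → Carrier
    firstLetter k i U y = if y ∉ᵇ U then (sign (above y U) * a i y) * leibniz k (suc i) (y ∷ U) else 0#

    avoids-[] : ∀ {k} (v : Vec (Fin n) k) → avoids [] v ≡ true
    avoids-[] []      = ≡.refl
    avoids-[] (x ∷ v) = avoids-[] v

    avoids-∷ : ∀ {k} U (x : Fin n) (v : Vec (Fin n) k) →
      avoids (toℕ x ∷ U) v ≡ notIn x v ∧ avoids U v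
    avoids-∷ U x []      = ≡.refl
    avoids-∷ U x (y ∷ v) with toℕ x ≡ᵇ toℕ y
    ... | true  = ≡.refl
    ... | false rewrite avoids-∷ U x v = ∧.x∙yz≈y∙xz (toℕ y ∉ᵇ U) (notIn x v) (avoids U v)

    admissible-∷ : ∀ {k} U (x : Fin n) (v : Vec (Fin n) k) →
      distinct (x ∷ v) ∧ avoids U (x ∷ v) ≡
      (if toℕ x ∉ᵇ U then distinct v ∧ avoids (toℕ x ∷ U) v else false)
    admissible-∷ U x v rewrite avoids-∷ U x v with toℕ x ∉ᵇ U | notIn x v
    ... | false | x∉v   = ∧-zeroʳ (x∉v ∧ distinct v)
    ... | true  | true  = ≡.refl
    ... | true  | false = ≡.sym (∧-zeroʳ (distinct v))

    term-∷ : ∀ {k} i U (x : Fin n) (v : Vec (Fin n) k) → term i U (x ∷ v) ≈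
      (if toℕ x ∉ᵇ U then (sign (above (toℕ x) U) * a i (toℕ x)) * term (suc i) (toℕ x ∷ U) v else 0#)
    term-∷ i U x v rewrite admissible-∷ U x v with toℕ x ∉ᵇ U
    ... | false = refl
    ... | true with distinct v ∧ avoids (toℕ x ∷ U) v
    ...   | false = sym (zeroʳ _)
    ...   | true  = begin
      sign (disorder U (x ∷ v)) * (a i (toℕ x) * weight (suc i) v)
        ≈⟨ *-congʳ (reflexive (≡.cong sign (disorder-∷ U x v))) ⟩
      sign (above (toℕ x) U +ℕ disorder (toℕ x ∷ U) v) * (a i (toℕ x) * weight (suc i) v)
        ≈⟨ *-congʳ (pow-homo-* (- 1#) (above (toℕ x) U) _) ⟩
      (sign (above (toℕ x) U) * sign (disorder (toℕ x ∷ U) v)) * (a i (toℕ x) * weight (suc i) v)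
        ≈⟨ *.interchange _ _ _ _ ⟩
      (sign (above (toℕ x) U) * a i (toℕ x)) * (sign (disorder (toℕ x ∷ U) v) * weight (suc i) v) ∎

    leibniz-suc : ∀ k i U → leibniz (suc k) i U ≈ ∑[ x ∈ allFin n ] firstLetter k i U (toℕ x)
    leibniz-suc k i U = trans (∑-concatMap (term i U) (λ x → map (x ∷_) (allVecs n k)) (allFin n))
                              (∑-cong (All.universal words-starting-with (allFin n)))
      where
      words-starting-with : ∀ x → ∑ (term i U) (map (x ∷_) (allVecs n k)) ≈ firstLetter k i U (toℕ x)
      words-starting-with x = begin
        ∑ (term i U) (map (x ∷_) (allVecs n k))   ≡⟨ ∑-map (term i U) (x ∷_) (allVecs n k) ⟩
        ∑[ v ∈ allVecs n k ] term i U (x ∷ v)    ≈⟨ ∑-cong (All.universal (term-∷ i U x) (allVecs n k)) ⟩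
        ∑[ v ∈ allVecs n k ] (if toℕ x ∉ᵇ U then (sign (above (toℕ x) U) * a i (toℕ x)) * term (suc i) (toℕ x ∷ U) v
                                              else 0#)
          ≈⟨ ∑-if (toℕ x ∉ᵇ U) _ (term (suc i) (toℕ x ∷ U)) (allVecs n k) ⟩
        firstLetter k i U (toℕ x) ∎

    leibniz≈det : ∀ k i U → length (complement n U) ≡ k →
      leibniz k i U ≈ sign (crossings U (complement n U)) * det k i (complement n U)
    leibniz≈det zero    i U len with complement n U | len
    ... | [] | _ =
      trans (+-identityʳ _) (*-congʳ (reflexive (≡.cong sign (+ℕ-identityʳ (crossings U [])))))
    leibniz≈det (suc k) i U len = begin
      leibniz (suc k) i U
        ≈⟨ leibniz-suc k i U ⟩
      ∑[ x ∈ allFin n ] firstLetter k i U (toℕ x)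
        ≈⟨ ∑-cong (All.universal pull-sign (allFin n)) ⟩
      ∑[ x ∈ allFin n ] (sign (crossings U C) * (if toℕ x ∉ᵇ U then expansion (toℕ x) else 0#))
        ≈⟨ *-distribˡ-∑ _ _ (allFin n) ⟨
      sign (crossings U C) * ∑[ x ∈ allFin n ] (if toℕ x ∉ᵇ U then expansion (toℕ x) else 0#)
        ≈⟨ *-congˡ (∑-complement n U expansion) ⟩
      sign (crossings U C) * det (suc k) i C ∎
      where
      C = complement n U
      expansion : ℕ → Carrier
      expansion y = sign (below y C) * (a i y * det k (suc i) (remove y C))
      use-letter : ∀ {y} → y < n → (y ∉ᵇ U) ≡ true →
        (sign (above y U) * a i y) * leibniz k (suc i) (y ∷ U) ≈ sign (crossings U C) * expansion y
      use-letter {y} y<n y∉U = begin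
        (sign (above y U) * a i y) * leibniz k (suc i) (y ∷ U)
          ≈⟨ *-congˡ (leibniz≈det k (suc i) (y ∷ U) (length-complement-∷ U y<n y∉U len)) ⟩
        (sign (above y U) * a i y) * (sign (crossings (y ∷ U) C′) * det k (suc i) C′)
          ≡⟨ ≡.cong (λ D → _ * (sign (crossings (y ∷ U) D) * det k (suc i) D)) (complement-∷ n y U) ⟩
        (sign (above y U) * a i y) * (sign (crossings (y ∷ U) (remove y C)) * det k (suc i) (remove y C))
          ≈⟨ *.interchange _ _ _ _ ⟩
        (sign (above y U) * sign (crossings (y ∷ U) (remove y C))) * (a i y * det k (suc i) (remove y C))
          ≈⟨ *-congʳ (pow-homo-* (- 1#) (above y U) _) ⟨
        sign (above y U +ℕ crossings (y ∷ U) (remove y C)) * (a i y * det k (suc i) (remove y C))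
          ≈⟨ *-congʳ (reflexive (≡.cong sign (crossings-transfer y C U once))) ⟩
        sign (crossings U C +ℕ below y C) * (a i y * det k (suc i) (remove y C))
          ≈⟨ trans (*-congʳ (pow-homo-* (- 1#) (crossings U C) _)) (*-assoc _ _ _) ⟩
        sign (crossings U C) * expansion y ∎
        where
        C′   = complement n (y ∷ U)
        once = occurrences-complement U y<n y∉U
      pull-sign : ∀ x →
        firstLetter k i U (toℕ x) ≈ sign (crossings U C) * (if toℕ x ∉ᵇ U then expansion (toℕ x) else 0#)
      pull-sign x with toℕ x ∉ᵇ U in x∉U
      ... | true  = use-letter (toℕ<n x) x∉U
      ... | false = sym (zeroʳ _)

  module ExcedanceMatrix (s t : Carrier) where

    w : ℕ → ℕ → Carrier
    w i j = if i <ᵇ j then s * pow R t (j ∸ i) else 1#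

    open Laplace w

    w-lower : ∀ {i j} → j ≤ i → w i j ≡ 1#
    w-lower {i} {j} j≤i rewrite dec-false (i <? j) (≤⇒≯ j≤i) = ≡.refl

    w-next : ∀ i → w i (suc i) ≈ s * t
    w-next i rewrite dec-true (i <? suc i) ≤-refl | m+n∸n≡m 1 i = *-congˡ (*-identityʳ t)

    lower-columns-agree : ∀ {i c c′} → c ≤ i → c′ ≤ i → ColumnsAgreeFrom i c c′
    lower-columns-agree c≤i c′≤i j i≤j =
      reflexive (≡.trans (w-lower (≤-trans c≤i i≤j)) (≡.sym (w-lower (≤-trans c′≤i i≤j))))

    det-w : ∀ k i c → c ≤ i → det (suc k) i (c ∷ range (suc i) k) ≈ pow R (1# - s * t) k
    det-w zero    i c c≤i = begin
      det 1 i (c ∷ [])  ≈⟨ det-expand-min zero i c [] [] ⟩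
      w i c * 1# + 0#   ≈⟨ trans (+-identityʳ _) (*-identityʳ _) ⟩
      w i c             ≡⟨ w-lower c≤i ⟩
      1#                ∎
    det-w (suc k) i c c≤i = begin
      det (suc (suc k)) i (c ∷ suc i ∷ R′)
        ≈⟨ det-expand-min (suc k) i c (suc i ∷ R′) (s≤s c≤i ∷ All.map (<-trans (s≤s c≤i)) i<R′) ⟩
      w i c * det (suc k) (suc i) (suc i ∷ R′) + (next + ∑[ y ∈ R′ ] later y)
        ≈⟨ +-cong (*-cong (reflexive (w-lower c≤i)) (det-w k (suc i) (suc i) ≤-refl))
                  (+-cong next≈ (∑-zero (All.map later≈0 i<R′))) ⟩
      1# * X + (- (s * t * X) + 0#)    ≈⟨ +-cong (*-identityˡ X) (+-identityʳ _) ⟩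
      X + - (s * t * X)                ≈⟨ +-congˡ (-‿distribˡ-* (s * t) X) ⟩
      X + - (s * t) * X                ≈⟨ +-congʳ (*-identityˡ X) ⟨
      1# * X + - (s * t) * X           ≈⟨ distribʳ X 1# (- (s * t)) ⟨
      (1# - s * t) * X                 ∎
      where
      R′ = range (suc (suc i)) k
      X  = pow R (1# - s * t) k
      i<R′ : All (suc i <_) R′
      i<R′ = All-range (suc (suc i)) k
      next : Carrier
      next = sign (suc (below (suc i) (suc i ∷ R′))) *
             (w i (suc i) * det (suc k) (suc i) (c ∷ remove (suc i) (suc i ∷ R′)))
      next≈ : next ≈ - (s * t * X)
      next≈ rewrite dec-false (i <? i) (<-irrefl ≡.refl) | below-min i<R′
                  | dec-true (i ≟ i) ≡.refl | remove-min i<R′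
        = trans (*-cong (*-identityʳ (- 1#)) (*-cong (w-next i) (det-w k (suc i) c (m≤n⇒m≤1+n c≤i))))
                (-1*x≈-x _)
      later : ℕ → Carrier
      later y = sign (suc (below y (suc i ∷ R′))) *
                (w i y * det (suc k) (suc i) (c ∷ remove y (suc i ∷ R′)))
      later≈0 : ∀ {y} → suc i < y → later y ≈ 0#
      later≈0 {y} i<y rewrite dec-false (y ≟ suc i) (>⇒≢ i<y) = trans (*-congˡ (trans (*-congˡ
        (det-equal-columns (suc k) (suc i) c (suc i) (remove y R′) (s≤s c≤i)
          (lower-columns-agree (m≤n⇒m≤1+n c≤i) ≤-refl) (filter⁺ _ i<R′))) (zeroʳ _))) (zeroʳ _)

    w-powers : ∀ i j → pow R s (excedanceAt i j) * pow R t (depthAt i j) ≈ w i j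
    w-powers i j with i <ᵇ j
    ... | true  = *-congʳ (*-identityʳ s)
    ... | false = *-identityˡ 1#

    module _ (n : ℕ) where

      open Leibniz w n

      powers≈weight : ∀ {k} i (v : Vec (Fin n) k) →
        pow R s (rowSum excedanceAt i v) * pow R t (rowSum depthAt i v) ≈ weight i v
      powers≈weight i []      = *-identityˡ 1#
      powers≈weight i (x ∷ v) = begin
        pow R s (e +ℕ E) * pow R t (d +ℕ D)
          ≈⟨ *-cong (pow-homo-* s e E) (pow-homo-* t d D) ⟩
        (pow R s e * pow R s E) * (pow R t d * pow R t D)
          ≈⟨ *.interchange _ _ _ _ ⟩
        (pow R s e * pow R t d) * (pow R s E * pow R t D)
          ≈⟨ *-cong (w-powers i (toℕ x)) (powers≈weight (suc i) v) ⟩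
        w i (toℕ x) * weight (suc i) v ∎
        where
        e = excedanceAt i (toℕ x)
        d = depthAt i (toℕ x)
        E = rowSum excedanceAt (suc i) v
        D = rowSum depthAt (suc i) v

      signedExcDepth≈leibniz : signedExcDepth R n s t ≈ leibniz n 0 []
      signedExcDepth≈leibniz =
        trans (∑-filterᵇ summand distinct (allVecs n n)) (∑-cong (All.universal summand≈term (allVecs n n)))
        where
        summand : Vec (Fin n) n → Carrier
        summand σ = sign (inv σ) * (pow R s (exc σ) * pow R t (depth σ))
        summand≈term : ∀ σ → (if distinct σ then summand σ else 0#) ≈ term 0 [] σ
        summand≈term σ rewrite avoids-[] σ | ∧-identityʳ (distinct σ)
                             | inv≡inversions σ | exc≡rowSum σ | depth≡rowSum σ
          with distinct σ
        ... | true  = *-congˡ (powers≈weight 0 σ)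
        ... | false = refl

theorem1p3 : ∀ {c ℓ : Level} (R : CommutativeRing c ℓ) (n : ℕ) (s t : CommutativeRing.Carrier R) →
    CommutativeRing._≈_ R (signedExcDepth R (suc n) s t)
      (pow R (CommutativeRing._-_ R (CommutativeRing.1# R) (CommutativeRing._*_ R s t)) n)
theorem1p3 R n s t = begin
  signedExcDepth R (suc n) s t                ≈⟨ signedExcDepth≈leibniz (suc n) ⟩
  leibniz (suc n) 0 []                        ≈⟨ leibniz≈det (suc n) 0 [] full-length ⟩
  1# * det (suc n) 0 (complement (suc n) [])  ≈⟨ *-identityˡ _ ⟩
  det (suc n) 0 (complement (suc n) [])       ≡⟨ ≡.cong (det (suc n) 0) (complement-[] (suc n)) ⟩
  det (suc n) 0 (0 ∷ range 1 n)               ≈⟨ det-w n 0 0 z≤n ⟩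
  pow R (1# - s * t) n                        ∎
  where
  open CommutativeRing R
  open import Relation.Binary.Reasoning.Setoid setoid
  open Counting
  open Determinants R
  open ExcedanceMatrix s t
  open Laplace w
  open Leibniz w (suc n)
  full-length : length (complement (suc n) []) ≡.≡ suc n
  full-length = ≡.trans (≡.cong length (complement-[] (suc n))) (length-range 0 (suc n))
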